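{- Let $G$ be a graph, $v\in V(G)$, and $S_v\subseteq V(G)\setminus\{v\}$ a set such that $G\setminus S_v$ is a block graph. Let $\mathcal{C}$ be the set of connected components of $G\setminus(S_v\cup\{v\})$. Then for each $C\in\mathcal{C}$ there is a block $\tilde B$ of $C$ such that $N_C(v)\subseteq V(\tilde B)$.
   Context: A block of a graph is a maximal $2$-connected subgraph (or a bridge/isolated vertex); a block graph is a graph in which every block is a clique. $N_C(v)$ denotes the set of neighbours of $v$ lying in $V(C)$. -}

module Defs where

open import Data.Nat using (ℕ)
open import Data.Fin using (Fin)
open import Data.Fin.Subset using (Subset; _∈_; _∉_; _⊆_; _-_)
open import Data.Product using (Σ; ∃; _×_)
open import Relation.Nullary using (¬_; Dec)
open import Relation.Binary.PropositionalEquality using (_≡_)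
open import Level using (0ℓ)

record Graph (n : ℕ) : Set₁ where
  field
    Adj    : Fin n → Fin n → Set
    adj?   : (x y : Fin n) → Dec (Adj x y)
    sym    : ∀ {x y} → Adj x y → Adj y x
    irrefl : ∀ {x} → ¬ Adj x x
open Graph public

module _ {n : ℕ} (G : Graph n) where

  data Walk (W : Subset n) : Fin n → Fin n → Set where
    here : ∀ {x} → x ∈ W → Walk W x x
    step : ∀ {x y z} → x ∈ W → Adj G x y → Walk W y z → Walk W x z

  -- G[W] is connected (the empty vertex set counts as connected here;
  -- nonemptiness is required separately where needed).
  Connected : Subset n → Set
  Connected W = ∀ x y → x ∈ W → y ∈ W → Walk W x y

  IsComponent : Subset n → Subset n → Set
  IsComponent U C =
    C ⊆ U × (∃ λ x → x ∈ C) × Connected C ×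
    (∀ D → C ⊆ D → D ⊆ U → Connected D → D ⊆ C)

  Nonseparable : Subset n → Set
  Nonseparable B = (∃ λ x → x ∈ B) × Connected B × (∀ x → x ∈ B → Connected (B - x))

  -- B is (the vertex set of) a block of G[U]: a maximal connected subgraph
  -- of G[U] without a cut vertex (covers 2-connected blocks, bridges and
  -- isolated vertices).  Blocks are induced subgraphs, so vertex sets suffice.
  IsBlock : Subset n → Subset n → Set
  IsBlock U B =
    B ⊆ U × Nonseparable B × (∀ D → B ⊆ D → D ⊆ U → Nonseparable D → D ⊆ B)

  IsClique : Subset n → Set
  IsClique B = ∀ x y → x ∈ B → y ∈ B → ¬ (x ≡ y) → Adj G x y

  IsBlockGraph : Subset n → Set
  IsBlockGraph U = ∀ B → IsBlock U B → IsClique B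

-- Let u, w be distinct neighbours of v in C. A path from u to w inside C closes up
-- with v to a cycle of G ∖ S_v; a cycle is nonseparable, so it lies in a block,
-- which is a clique, hence u ~ w. Thus N_C(v) is a clique of C; cliques are
-- nonseparable, so N_C(v) extends to a block of C.
module Submission where

open import Defs
open import Data.Nat using (ℕ; zero; suc)
open import Data.Fin using (Fin; zero; suc; _≟_)
open import Data.Fin.Properties using (any?; all?)
open import Data.Fin.Subset using (Subset; _∈_; _∉_; _⊆_; _⊂_; _⊃_; ∁; _∪_; _─_; _-_; ⁅_⁆; outside)
open import Data.Fin.Subset.Properties
  using (_∈?_; _⊆?_; _⊂?_; anySubset?; x∈⁅x⁆; x∈⁅y⁆⇒x≡y; x∈p∪q⁺; x∈p∪q⁻; q⊆p∪q; p─q⊆p; x∈p∧x≢y⇒x∈p-y; x∈p⇒p-x⊂p; x∉p⇒x∈∁p)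
open import Data.Fin.Subset.Induction using (Acc; acc; ⊂-wellFounded; ⊃-wellFounded)
open import Data.Vec using ([]; _∷_; here; there)
open import Data.Product using (∃; _×_; _,_; proj₁)
open import Data.Empty using (⊥-elim)
open import Data.Sum using (_⊎_; inj₁; inj₂)
open import Function using (_∘_; id)
open import Relation.Nullary using (Dec; yes; no; does; contradiction)
open import Relation.Nullary.Decidable using (_×-dec_; _→-dec_; map′)
open import Relation.Binary.PropositionalEquality using (_≡_; _≢_; refl)
import Relation.Binary.PropositionalEquality as ≡

select : ∀ {n} {P : Fin n → Set} → (∀ x → Dec (P x)) → Subset n
select {zero}  P? = []
select {suc n} P? = does (P? zero) ∷ select (P? ∘ suc)

∈-select⁺ : ∀ {n} {P : Fin n → Set} (P? : ∀ x → Dec (P x)) {x} → P x → x ∈ select P?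
∈-select⁺ P? {zero} px with P? zero
... | yes _   = here
... | no ¬px  = contradiction px ¬px
∈-select⁺ P? {suc x} px = there (∈-select⁺ (P? ∘ suc) px)

∈-select⁻ : ∀ {n} {P : Fin n → Set} (P? : ∀ x → Dec (P x)) {x} → x ∈ select P? → P x
∈-select⁻ P? {zero} x∈ with P? zero | x∈
... | yes px | _ = px
∈-select⁻ P? {suc x} (there x∈) = ∈-select⁻ (P? ∘ suc) x∈

x∈p─q⇒x∉q : ∀ {n} (p q : Subset n) {x} → x ∈ p ─ q → x ∉ q
x∈p─q⇒x∉q (_ ∷ p) (outside ∷ q) here       = λ ()
x∈p─q⇒x∉q (_ ∷ p) (_ ∷ q)       (there x∈) = λ { (there x∈q) → x∈p─q⇒x∉q p q x∈ x∈q }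

module _ {n : ℕ} where

  private variable
    p q : Subset n
    x y : Fin n

  x∈p-y⇒x∈p : x ∈ p - y → x ∈ p
  x∈p-y⇒x∈p {p = p} {y = y} = p─q⊆p p ⁅ y ⁆

  x∈p-y⇒x≢y : x ∈ p - y → x ≢ y
  x∈p-y⇒x≢y {p = p} {y = y} x∈ refl = x∈p─q⇒x∉q p ⁅ y ⁆ x∈ (x∈⁅x⁆ y)

  p⊆q⇒p-x⊆q-x : p ⊆ q → p - x ⊆ q - x
  p⊆q⇒p-x⊆q-x p⊆q x∈ = x∈p∧x≢y⇒x∈p-y (p⊆q (x∈p-y⇒x∈p x∈)) (x∈p-y⇒x≢y x∈)

  x∈⁅y⁆∪p⁻ : x ∈ ⁅ y ⁆ ∪ p → x ≡ y ⊎ x ∈ p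
  x∈⁅y⁆∪p⁻ {y = y} {p = p} x∈ with x∈p∪q⁻ ⁅ y ⁆ p x∈
  ... | inj₁ x∈⁅y⁆ = inj₁ (x∈⁅y⁆⇒x≡y y x∈⁅y⁆)
  ... | inj₂ x∈p   = inj₂ x∈p

module _ {n : ℕ} (G : Graph n) where

  private variable
    U W T : Subset n
    a b c v x y z : Fin n

  walk-start : Walk G W x y → x ∈ W
  walk-start (here x∈)     = x∈
  walk-start (step x∈ _ _) = x∈

  walk-end : Walk G W x y → y ∈ W
  walk-end (here y∈)    = y∈
  walk-end (step _ _ w) = walk-end w

  _++_ : Walk G W x y → Walk G W y z → Walk G W x z
  here _      ++ w′ = w′
  step x∈ e w ++ w′ = step x∈ e (w ++ w′)

  reverse : Walk G W x y → Walk G W y x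
  reverse (here x∈)     = here x∈
  reverse (step x∈ e w) = reverse w ++ step (walk-start w) (sym G e) (here x∈)

  walk-mono : W ⊆ T → Walk G W x y → Walk G T x y
  walk-mono W⊆T (here x∈)     = here (W⊆T x∈)
  walk-mono W⊆T (step x∈ e w) = step (W⊆T x∈) e (walk-mono W⊆T w)

  hub⇒connected : (∀ {z} → z ∈ W → Walk G W z c) → Connected G W
  hub⇒connected to-hub _ _ x∈ y∈ = to-hub x∈ ++ reverse (to-hub y∈)

  lastExit : y ≢ x → Walk G W a y →
             Walk G (W - x) a y ⊎ ∃ λ z → Adj G x z × Walk G (W - x) z y
  lastExit y≢x (here a∈) = inj₁ (here (x∈p∧x≢y⇒x∈p-y a∈ y≢x))
  lastExit {x = x} y≢x (step {x = a} a∈ e w) with lastExit y≢x w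
  ... | inj₂ exit = inj₂ exit
  ... | inj₁ w′ with a ≟ x
  ...   | yes refl = inj₂ (_ , e , w′)
  ...   | no a≢x   = inj₁ (step (x∈p∧x≢y⇒x∈p-y a∈ a≢x) e w′)

  avoidingTail : x ≢ y → Walk G W x y → ∃ λ z → Adj G x z × Walk G (W - x) z y
  avoidingTail x≢y (here _) = contradiction refl x≢y
  avoidingTail x≢y (step _ e w) with lastExit (x≢y ∘ ≡.sym) w
  ... | inj₁ w′   = _ , e , w′
  ... | inj₂ exit = exit

  walk? : Acc _⊂_ W → ∀ x y → Dec (Walk G W x y)
  walk? {W} (acc rs) x y with x ∈? W
  ... | no x∉W = no (x∉W ∘ walk-start)
  ... | yes x∈W with x ≟ y
  ...   | yes refl = yes (here x∈W)
  ...   | no x≢y   = map′ (λ (_ , e , w) → step x∈W e (walk-mono x∈p-y⇒x∈p w)) (avoidingTail x≢y)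
                       (any? λ z → adj? G x z ×-dec walk? (rs (x∈p⇒p-x⊂p x∈W)) z y)

  connected? : ∀ W → Dec (Connected G W)
  connected? W = all? λ x → all? λ y → x ∈? W →-dec (y ∈? W →-dec walk? (⊂-wellFounded W) x y)

  nonseparable? : ∀ B → Dec (Nonseparable G B)
  nonseparable? B = any? (_∈? B) ×-dec (connected? B ×-dec all? λ x → x ∈? B →-dec connected? (B - x))

  extendToBlock : ∀ {X} → Acc _⊃_ X → X ⊆ U → Nonseparable G X → ∃ λ B → IsBlock G U B × X ⊆ B
  extendToBlock {U} {X} (acc rs) X⊆U nsX
    with anySubset? (λ D → X ⊂? D ×-dec (D ⊆? U ×-dec nonseparable? D))
  ... | yes (D , X⊂D@(X⊆D , _) , D⊆U , nsD) with extendToBlock (rs X⊂D) D⊆U nsD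
  ...   | B , isBlock , D⊆B = B , isBlock , D⊆B ∘ X⊆D
  extendToBlock {U} {X} (acc rs) X⊆U nsX
      | no ∄D = X , (X⊆U , nsX , maximal) , id
    where
      maximal : ∀ D → X ⊆ D → D ⊆ U → Nonseparable G D → D ⊆ X
      maximal D X⊆D D⊆U nsD {x} x∈D with x ∈? X
      ... | yes x∈X = x∈X
      ... | no x∉X  = ⊥-elim (∄D (D , (X⊆D , x , x∈D , x∉X) , D⊆U , nsD))

  ⊆-block : ∀ {X} → X ⊆ U → Nonseparable G X → ∃ λ B → IsBlock G U B × X ⊆ B
  ⊆-block {X = X} = extendToBlock (⊃-wellFounded X)

  clique⇒connected : ∀ {B} → IsClique G B → Connected G B
  clique⇒connected clique a b a∈ b∈ with a ≟ b
  ... | yes refl = here a∈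
  ... | no a≢b   = step a∈ (clique a b a∈ b∈ a≢b) (here b∈)

  clique⇒nonseparable : ∀ {B} → ∃ (_∈ B) → IsClique G B → Nonseparable G B
  clique⇒nonseparable nonempty clique =
    nonempty , clique⇒connected clique ,
    λ _ _ → clique⇒connected (λ a b a∈ b∈ → clique a b (x∈p-y⇒x∈p a∈) (x∈p-y⇒x∈p b∈))

  ⁅x⁆-isClique : ∀ x → IsClique G ⁅ x ⁆
  ⁅x⁆-isClique x a b a∈ b∈ a≢b = contradiction (≡.trans (x∈⁅y⁆⇒x≡y x a∈) (≡.sym (x∈⁅y⁆⇒x≡y x b∈))) a≢b

  -- The tail of a path avoids its first vertex, so paths are simple by construction.
  data Path (W : Subset n) : Fin n → Fin n → Set where
    end  : x ∈ W → Path W x x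
    cons : x ∈ W → Adj G x y → Path (W - x) y z → Path W x z

  toPath : Acc _⊂_ W → Walk G W x y → Path W x y
  toPath {x = x} {y} (acc rs) w with x ≟ y
  ... | yes refl = end (walk-start w)
  ... | no x≢y with avoidingTail x≢y w
  ...   | _ , e , w′ = cons (walk-start w) e (toPath (rs (x∈p⇒p-x⊂p (walk-start w))) w′)

  support : Path W x y → Subset n
  support {x = x} (end _)      = ⁅ x ⁆
  support {x = x} (cons _ _ p) = ⁅ x ⁆ ∪ support p

  start∈support : (p : Path W x y) → x ∈ support p
  start∈support {x = x} (end _)      = x∈⁅x⁆ x
  start∈support {x = x} (cons _ _ p) = x∈p∪q⁺ (inj₁ (x∈⁅x⁆ x))

  support⊆ : (p : Path W x y) → support p ⊆ W
  support⊆ (end x∈) z∈ with x∈⁅y⁆⇒x≡y _ z∈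
  ... | refl = x∈
  support⊆ (cons x∈ _ p) z∈ with x∈⁅y⁆∪p⁻ z∈
  ... | inj₁ refl = x∈
  ... | inj₂ z∈p  = x∈p-y⇒x∈p (support⊆ p z∈p)

  toEnd : (p : Path W x y) → z ∈ support p → Walk G (support p) z y
  toEnd (end x∈) z∈ with x∈⁅y⁆⇒x≡y _ z∈
  ... | refl = here z∈
  toEnd (cons x∈ e p) z∈ with x∈⁅y⁆∪p⁻ z∈
  ... | inj₁ refl = step z∈ e (walk-mono (q⊆p∪q _ _) (toEnd p (start∈support p)))
  ... | inj₂ z∈p  = walk-mono (q⊆p∪q _ _) (toEnd p z∈p)

  toWalk : (p : Path W x y) → Walk G (support p) x y
  toWalk p = toEnd p (start∈support p)

  tail-avoids-head : (p : Path (W - x) y z) → support p ⊆ (⁅ x ⁆ ∪ support p) - x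
  tail-avoids-head p u∈ = x∈p∧x≢y⇒x∈p-y (q⊆p∪q _ _ u∈) (x∈p-y⇒x≢y (support⊆ p u∈))

  reachesEnd : (p : Path W a b) → z ∈ support p → z ≢ x →
               Walk G (support p - x) z a ⊎ Walk G (support p - x) z b
  reachesEnd (end _) z∈ z≢x with x∈⁅y⁆⇒x≡y _ z∈
  ... | refl = inj₁ (here (x∈p∧x≢y⇒x∈p-y z∈ z≢x))
  reachesEnd {x = x} (cons {x = a} a∈ e p) z∈ z≢x with x∈⁅y⁆∪p⁻ z∈
  ... | inj₁ refl = inj₁ (here (x∈p∧x≢y⇒x∈p-y z∈ z≢x))
  ... | inj₂ z∈p with reachesEnd p z∈p z≢x | a ≟ x
  ...   | inj₂ w | _        = inj₂ (walk-mono (p⊆q⇒p-x⊆q-x (q⊆p∪q _ _)) w)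
  ...   | inj₁ _ | yes refl = inj₂ (walk-mono (tail-avoids-head p) (toEnd p z∈p))
  ...   | inj₁ w | no a≢x   = inj₁ (w′ ++ step (walk-end w′) (sym G e) (here a∈S-x))
    where
      w′ = walk-mono (p⊆q⇒p-x⊆q-x (q⊆p∪q _ _)) w
      a∈S-x = x∈p∧x≢y⇒x∈p-y (start∈support (cons a∈ e p)) a≢x

  cycle-nonseparable : (p : Path W a b) → v ∉ W → Adj G v a → Adj G v b →
                       Nonseparable G (⁅ v ⁆ ∪ support p)
  cycle-nonseparable {a = a} {v = v} p v∉W va vb = (v , v∈Q) , connected-Q , connected-Q-
    where
      S = support p
      Q = ⁅ v ⁆ ∪ S

      v∈Q : v ∈ Q
      v∈Q = x∈p∪q⁺ (inj₁ (x∈⁅x⁆ v))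

      S⊆Q : S ⊆ Q
      S⊆Q = q⊆p∪q _ _

      S∌v : z ∈ S → z ≢ v
      S∌v z∈ refl = v∉W (support⊆ p z∈)

      toV : ∀ x → S - x ⊆ T → v ∈ T → z ∈ S → z ≢ x → Walk G T z v
      toV x S-x⊆T v∈T z∈ z≢x with reachesEnd p z∈ z≢x
      ... | inj₁ w = walk-mono S-x⊆T w ++ step (S-x⊆T (walk-end w)) (sym G va) (here v∈T)
      ... | inj₂ w = walk-mono S-x⊆T w ++ step (S-x⊆T (walk-end w)) (sym G vb) (here v∈T)

      connected-Q : Connected G Q
      connected-Q = hub⇒connected λ z∈ → toV′ (x∈⁅y⁆∪p⁻ z∈)
        where
          toV′ : z ≡ v ⊎ z ∈ S → Walk G Q z v
          toV′ (inj₁ refl) = here v∈Q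
          toV′ (inj₂ z∈S)  = toV v (S⊆Q ∘ x∈p-y⇒x∈p) v∈Q z∈S (S∌v z∈S)

      connected-Q-v : Connected G (Q - v)
      connected-Q-v = hub⇒connected λ z∈ → toStart (x∈⁅y⁆∪p⁻ (x∈p-y⇒x∈p z∈)) (x∈p-y⇒x≢y z∈)
        where
          S⊆Q-v : S ⊆ Q - v
          S⊆Q-v z∈ = x∈p∧x≢y⇒x∈p-y (S⊆Q z∈) (S∌v z∈)

          toStart : z ≡ v ⊎ z ∈ S → z ≢ v → Walk G (Q - v) z a
          toStart (inj₁ refl) z≢v = contradiction refl z≢v
          toStart (inj₂ z∈S) z≢v with reachesEnd p z∈S z≢v
          ... | inj₁ w = walk-mono (S⊆Q-v ∘ x∈p-y⇒x∈p) w
          ... | inj₂ w = walk-mono (S⊆Q-v ∘ x∈p-y⇒x∈p) w ++ reverse (walk-mono S⊆Q-v (toWalk p))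

      connected-Q-x : x ≢ v → Connected G (Q - x)
      connected-Q-x {x} x≢v = hub⇒connected λ z∈ → toV′ (x∈⁅y⁆∪p⁻ (x∈p-y⇒x∈p z∈)) (x∈p-y⇒x≢y z∈)
        where
          v∈Q-x : v ∈ Q - x
          v∈Q-x = x∈p∧x≢y⇒x∈p-y v∈Q (x≢v ∘ ≡.sym)

          toV′ : z ≡ v ⊎ z ∈ S → z ≢ x → Walk G (Q - x) z v
          toV′ (inj₁ refl) _ = here v∈Q-x
          toV′ (inj₂ z∈S) z≢x = toV x (p⊆q⇒p-x⊆q-x S⊆Q) v∈Q-x z∈S z≢x

      connected-Q- : ∀ x → x ∈ Q → Connected G (Q - x)
      connected-Q- x _ with x ≟ v
      ... | yes refl = connected-Q-v
      ... | no x≢v   = connected-Q-x x≢v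

  neighbours-adjacent : IsBlockGraph G U → W ⊆ U → v ∈ U → v ∉ W →
                        Adj G v a → Adj G v b → Walk G W a b → a ≢ b → Adj G a b
  neighbours-adjacent {U} {W} {v} {a} {b} isBlockGraph W⊆U v∈U v∉W va vb w a≢b =
    adjacent (⊆-block Q⊆U (cycle-nonseparable p v∉W va vb))
    where
      p = toPath (⊂-wellFounded W) w
      Q = ⁅ v ⁆ ∪ support p

      Q⊆U : Q ⊆ U
      Q⊆U z∈ with x∈⁅y⁆∪p⁻ z∈
      ... | inj₁ refl = v∈U
      ... | inj₂ z∈S  = W⊆U (support⊆ p z∈S)

      a∈Q : a ∈ Q
      a∈Q = q⊆p∪q _ _ (start∈support p)

      b∈Q : b ∈ Q
      b∈Q = q⊆p∪q _ _ (walk-end (toWalk p))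

      adjacent : ∃ (λ B → IsBlock G U B × Q ⊆ B) → Adj G a b
      adjacent (B , isBlock , Q⊆B) = isBlockGraph B isBlock a b (Q⊆B a∈Q) (Q⊆B b∈Q) a≢b

  neighbours-in-block : ∀ {C} → IsBlockGraph G U → v ∈ U → C ⊆ U - v → x ∈ C → Connected G C →
                        ∃ λ B → IsBlock G C B × (∀ u → u ∈ C → Adj G v u → u ∈ B)
  neighbours-in-block {U} {v} {x} {C} isBlockGraph v∈U C⊆U-v x∈C connected-C =
    let X , X⊆C , nonempty , X-isClique , N⊆X = seed (any? (_∈? N))
        B , isBlock , X⊆B = ⊆-block X⊆C (clique⇒nonseparable nonempty X-isClique)
    in  B , isBlock , λ u u∈C vu → X⊆B (N⊆X (∈-select⁺ _ (u∈C , vu)))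
    where
      N = select (λ u → u ∈? C ×-dec adj? G v u)

      N-isClique : IsClique G N
      N-isClique a b a∈N b∈N a≢b with ∈-select⁻ _ a∈N | ∈-select⁻ _ b∈N
      ... | a∈C , va | b∈C , vb =
        neighbours-adjacent isBlockGraph (x∈p-y⇒x∈p ∘ C⊆U-v) v∈U (λ v∈C → x∈p-y⇒x≢y (C⊆U-v v∈C) refl)
          va vb (connected-C a b a∈C b∈C) a≢b

      -- If v has no neighbour in C, any vertex of C seeds the block.
      seed : Dec (∃ (_∈ N)) → ∃ λ X → X ⊆ C × ∃ (_∈ X) × IsClique G X × N ⊆ X
      seed (yes nonempty) = N , proj₁ ∘ ∈-select⁻ _ , nonempty , N-isClique , id
      seed (no ∄u) = ⁅ x ⁆ , ⁅x⁆⊆C , (x , x∈⁅x⁆ x) , ⁅x⁆-isClique x , λ u∈N → ⊥-elim (∄u (_ , u∈N))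
        where
          ⁅x⁆⊆C : ⁅ x ⁆ ⊆ C
          ⁅x⁆⊆C y∈ with x∈⁅y⁆⇒x≡y x y∈
          ... | refl = x∈C

lemma9 : (n : ℕ) (G : Graph n) (v : Fin n) (S : Subset n) → v ∉ S →
    IsBlockGraph G (∁ S) →
    ∀ C → IsComponent G (∁ S - v) C →
    ∃ λ B → IsBlock G C B × (∀ u → u ∈ C → Adj G v u → u ∈ B)
lemma9 n G v S v∉S isBlockGraph C (C⊆∁S-v , (_ , x∈C) , connected-C , _) =
  neighbours-in-block G isBlockGraph (x∉p⇒x∈∁p v∉S) C⊆∁S-v x∈C connected-C
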